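{- Let $\rho$ be a $V$-pointed higher-order GSOS law of $\Sigma$ over $B$. Then every $\Sigma$-algebra $(A,a)$ induces a unique morphism $a^\clubsuit\colon\mu\Sigma\to B(A,A)$ in $\mathbb{C}$ such that $a^\clubsuit\circ\iota = B(\mathrm{id}_A,\hat a)\circ B(\mathrm{id}_A,\Sigma^\star\nabla)\circ\rho_{A,A}\circ\Sigma\langle(\!|a|\!),a^\clubsuit\rangle$.
   Context: $\mathbb{C}$ is a category with finite limits and finite colimits, $V$ an object of $\mathbb{C}$, and $\Sigma=V+\Sigma'\colon\mathbb{C}\to\mathbb{C}$ where $\Sigma'$ admits free algebras, so the free monad $\Sigma^\star$ exists. $(\mu\Sigma,\iota)$ is the initial $\Sigma$-algebra; $(\!|a|\!)\colon\mu\Sigma\to A$ the unique algebra morphism into $(A,a)$; $\hat a\colon\Sigma^\star A\to A$ the unique $\Sigma$-algebra morphism from the free algebra extending $\mathrm{id}_A$; $\nabla\colon A+A\to A$ the codiagonal. $B\colon\mathbb{C}^{\mathsf{op}}\times\mathbb{C}\to\mathbb{C}$ is a functor. $V/\mathbb{C}$ is the coslice category of $V$-pointed objects $(X,p_X\colon V\to X)$, $j\colon V/\mathbb{C}\to\mathbb{C}$ the forgetful functor, and each $\Sigma$-algebra $(A,a)$ is pointed by $a\circ\mathrm{inl}\colon V\to A$ (using $\Sigma A=V+\Sigma'A$). A $V$-pointed higher-order GSOS law is a family $\rho_{X,Y}\colon\Sigma(jX\times B(jX,Y))\to B(jX,\Sigma^\star(jX+Y))$ dinatural in $X\in V/\mathbb{C}$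 and natural in $Y\in\mathbb{C}$. -}

module Defs where

open import Level using (Level; _⊔_; suc)
open import Relation.Binary.PropositionalEquality using (_≡_)
open import Data.Product using (Σ; _×_; _,_)

record Category (o ℓ : Level) : Set (suc (o ⊔ ℓ)) where
  infixr 9 _∘_
  field
    Obj  : Set o
    Hom  : Obj → Obj → Set ℓ
    id   : ∀ {X} → Hom X X
    _∘_  : ∀ {X Y Z} → Hom Y Z → Hom X Y → Hom X Z
    assoc : ∀ {W X Y Z} (h : Hom Y Z) (g : Hom X Y) (f : Hom W X) →
            (h ∘ g) ∘ f ≡ h ∘ (g ∘ f)
    identityˡ : ∀ {X Y} (f : Hom X Y) → id ∘ f ≡ f
    identityʳ : ∀ {X Y} (f : Hom X Y) → f ∘ id ≡ f

module _ {o ℓ : Level} (C : Category o ℓ) where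
  open Category C

  record Terminal : Set (o ⊔ ℓ) where
    field
      ⊤ : Obj
      ! : ∀ {X} → Hom X ⊤
      !-unique : ∀ {X} (f : Hom X ⊤) → f ≡ !

  record BinaryProducts : Set (o ⊔ ℓ) where
    infixr 7 _⊗_
    field
      _⊗_ : Obj → Obj → Obj
      π₁  : ∀ {X Y} → Hom (X ⊗ Y) X
      π₂  : ∀ {X Y} → Hom (X ⊗ Y) Y
      ⟨_,_⟩ : ∀ {Z X Y} → Hom Z X → Hom Z Y → Hom Z (X ⊗ Y)
      π₁-β : ∀ {Z X Y} (f : Hom Z X) (g : Hom Z Y) → π₁ ∘ ⟨ f , g ⟩ ≡ f
      π₂-β : ∀ {Z X Y} (f : Hom Z X) (g : Hom Z Y) → π₂ ∘ ⟨ f , g ⟩ ≡ g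
      ⟨⟩-unique : ∀ {Z X Y} (f : Hom Z X) (g : Hom Z Y) (h : Hom Z (X ⊗ Y)) →
                  π₁ ∘ h ≡ f → π₂ ∘ h ≡ g → h ≡ ⟨ f , g ⟩
    _⁂_ : ∀ {X X' Y Y'} → Hom X X' → Hom Y Y' → Hom (X ⊗ Y) (X' ⊗ Y')
    f ⁂ g = ⟨ f ∘ π₁ , g ∘ π₂ ⟩

  record Equalizers : Set (o ⊔ ℓ) where
    field
      Eq  : ∀ {X Y} → Hom X Y → Hom X Y → Obj
      eq  : ∀ {X Y} (f g : Hom X Y) → Hom (Eq f g) X
      eq-equal : ∀ {X Y} (f g : Hom X Y) → f ∘ eq f g ≡ g ∘ eq f g
      eq-factor : ∀ {X Y Z} (f g : Hom X Y) (h : Hom Z X) → f ∘ h ≡ g ∘ h → Hom Z (Eq f g)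
      eq-factor-β : ∀ {X Y Z} (f g : Hom X Y) (h : Hom Z X) (p : f ∘ h ≡ g ∘ h) →
                    eq f g ∘ eq-factor f g h p ≡ h
      eq-factor-unique : ∀ {X Y Z} (f g : Hom X Y) (h : Hom Z X) (p : f ∘ h ≡ g ∘ h)
                         (k : Hom Z (Eq f g)) → eq f g ∘ k ≡ h → k ≡ eq-factor f g h p

  record FinitelyComplete : Set (o ⊔ ℓ) where
    field
      terminal   : Terminal
      products   : BinaryProducts
      equalizers : Equalizers

  record Initial : Set (o ⊔ ℓ) where
    field
      ⊥ : Obj
      ¡ : ∀ {X} → Hom ⊥ X
      ¡-unique : ∀ {X} (f : Hom ⊥ X) → f ≡ ¡

  record BinaryCoproducts : Set (o ⊔ ℓ) where
    infixr 6 _⊕_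
    field
      _⊕_ : Obj → Obj → Obj
      inl : ∀ {X Y} → Hom X (X ⊕ Y)
      inr : ∀ {X Y} → Hom Y (X ⊕ Y)
      [_,_] : ∀ {X Y Z} → Hom X Z → Hom Y Z → Hom (X ⊕ Y) Z
      inl-β : ∀ {X Y Z} (f : Hom X Z) (g : Hom Y Z) → [ f , g ] ∘ inl ≡ f
      inr-β : ∀ {X Y Z} (f : Hom X Z) (g : Hom Y Z) → [ f , g ] ∘ inr ≡ g
      []-unique : ∀ {X Y Z} (f : Hom X Z) (g : Hom Y Z) (h : Hom (X ⊕ Y) Z) →
                  h ∘ inl ≡ f → h ∘ inr ≡ g → h ≡ [ f , g ]
    _⊹_ : ∀ {X X' Y Y'} → Hom X X' → Hom Y Y' → Hom (X ⊕ Y) (X' ⊕ Y')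
    f ⊹ g = [ inl ∘ f , inr ∘ g ]
    ∇ : ∀ {X} → Hom (X ⊕ X) X
    ∇ = [ id , id ]

  record Coequalizers : Set (o ⊔ ℓ) where
    field
      Coeq : ∀ {X Y} → Hom X Y → Hom X Y → Obj
      coeq : ∀ {X Y} (f g : Hom X Y) → Hom Y (Coeq f g)
      coeq-equal : ∀ {X Y} (f g : Hom X Y) → coeq f g ∘ f ≡ coeq f g ∘ g
      coeq-factor : ∀ {X Y Z} (f g : Hom X Y) (h : Hom Y Z) → h ∘ f ≡ h ∘ g → Hom (Coeq f g) Z
      coeq-factor-β : ∀ {X Y Z} (f g : Hom X Y) (h : Hom Y Z) (p : h ∘ f ≡ h ∘ g) →
                      coeq-factor f g h p ∘ coeq f g ≡ h
      coeq-factor-unique : ∀ {X Y Z} (f g : Hom X Y) (h : Hom Y Z) (p : h ∘ f ≡ h ∘ g)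
                           (k : Hom (Coeq f g) Z) → k ∘ coeq f g ≡ h → k ≡ coeq-factor f g h p

  record FinitelyCocomplete : Set (o ⊔ ℓ) where
    field
      initial      : Initial
      coproducts   : BinaryCoproducts
      coequalizers : Coequalizers

  record EndoMap : Set (o ⊔ ℓ) where
    field
      F₀ : Obj → Obj
      F₁ : ∀ {X Y} → Hom X Y → Hom (F₀ X) (F₀ Y)

  record Endofunctor : Set (o ⊔ ℓ) where
    field
      F₀ : Obj → Obj
      F₁ : ∀ {X Y} → Hom X Y → Hom (F₀ X) (F₀ Y)
      F-id : ∀ {X} → F₁ (id {X}) ≡ id
      F-∘  : ∀ {X Y Z} (g : Hom Y Z) (f : Hom X Y) → F₁ (g ∘ f) ≡ F₁ g ∘ F₁ f
    endoMap : EndoMap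
    endoMap = record { F₀ = F₀ ; F₁ = F₁ }

  record Bifunctor : Set (o ⊔ ℓ) where
    field
      B₀ : Obj → Obj → Obj
      B₁ : ∀ {X X' Y Y'} → Hom X' X → Hom Y Y' → Hom (B₀ X Y) (B₀ X' Y')
      B-id : ∀ {X Y} → B₁ (id {X}) (id {Y}) ≡ id
      B-∘  : ∀ {X X' X'' Y Y' Y''} (f' : Hom X'' X') (f : Hom X' X)
             (g' : Hom Y' Y'') (g : Hom Y Y') →
             B₁ (f ∘ f') (g' ∘ g) ≡ B₁ f' g' ∘ B₁ f g

  module _ (F : EndoMap) where
    open EndoMap F

    record Algebra : Set (o ⊔ ℓ) where
      constructor alg
      field
        carrier   : Obj
        structure : Hom (F₀ carrier) carrier

    IsAlgHom : (A B : Algebra) → Hom (Algebra.carrier A) (Algebra.carrier B) → Set ℓ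
    IsAlgHom (alg A a) (alg B b) h = h ∘ a ≡ b ∘ F₁ h

    record InitialAlgebra : Set (o ⊔ ℓ) where
      field
        μ    : Obj
        ι    : Hom (F₀ μ) μ
        fold : (A : Algebra) → Hom μ (Algebra.carrier A)
        fold-hom : (A : Algebra) → IsAlgHom (alg μ ι) A (fold A)
        fold-unique : (A : Algebra) (h : Hom μ (Algebra.carrier A)) →
                      IsAlgHom (alg μ ι) A h → h ≡ fold A

    record FreeAlgebra (X : Obj) : Set (o ⊔ ℓ) where
      field
        T   : Obj
        τ   : Hom (F₀ T) T
        η   : Hom X T
        ext : (A : Algebra) → Hom X (Algebra.carrier A) → Hom T (Algebra.carrier A)
        ext-hom : (A : Algebra) (f : Hom X (Algebra.carrier A)) →
                  IsAlgHom (alg T τ) A (ext A f)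
        ext-η : (A : Algebra) (f : Hom X (Algebra.carrier A)) → ext A f ∘ η ≡ f
        ext-unique : (A : Algebra) (f : Hom X (Algebra.carrier A))
                     (h : Hom T (Algebra.carrier A)) →
                     IsAlgHom (alg T τ) A h → h ∘ η ≡ f → h ≡ ext A f

    FreeAlgebras : Set (o ⊔ ℓ)
    FreeAlgebras = (X : Obj) → FreeAlgebra X

    module FreeMonad (fr : FreeAlgebras) where
      F⋆₀ : Obj → Obj
      F⋆₀ X = FreeAlgebra.T (fr X)

      F⋆₁ : ∀ {X Y} → Hom X Y → Hom (F⋆₀ X) (F⋆₀ Y)
      F⋆₁ {X} {Y} f =
        FreeAlgebra.ext (fr X) (alg (F⋆₀ Y) (FreeAlgebra.τ (fr Y))) (FreeAlgebra.η (fr Y) ∘ f)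

      hat : (A : Algebra) → Hom (F⋆₀ (Algebra.carrier A)) (Algebra.carrier A)
      hat A = FreeAlgebra.ext (fr (Algebra.carrier A)) A id

  module Setting (colim : FinitelyCocomplete) (lim : FinitelyComplete)
                 (V : Obj) (Σ' : Endofunctor) where
    open BinaryCoproducts (FinitelyCocomplete.coproducts colim)
    open BinaryProducts (FinitelyComplete.products lim)

    ΣF : EndoMap
    ΣF = record { F₀ = λ X → V ⊕ Endofunctor.F₀ Σ' X
                ; F₁ = λ f → id ⊹ Endofunctor.F₁ Σ' f }

    record Pointed : Set (o ⊔ ℓ) where
      constructor pointed
      field
        obj : Obj
        pt  : Hom V obj

    IsPointedHom : (X X' : Pointed) → Hom (Pointed.obj X) (Pointed.obj X') → Set ℓ
    IsPointedHom (pointed X p) (pointed X' p') f = f ∘ p ≡ p'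

    algPointed : Algebra ΣF → Pointed
    algPointed (alg A a) = pointed A (a ∘ inl)

    module Law (fr : FreeAlgebras ΣF) (B : Bifunctor) where
      open FreeMonad ΣF fr
      open Bifunctor B
      open EndoMap ΣF renaming (F₀ to Σ₀; F₁ to Σ₁)
      open Pointed

      record PointedGSOSLaw : Set (o ⊔ ℓ) where
        field
          ρ : (X : Pointed) (Y : Obj) →
              Hom (Σ₀ (obj X ⊗ B₀ (obj X) Y)) (B₀ (obj X) (F⋆₀ (obj X ⊕ Y)))
          natural : (X : Pointed) {Y Y' : Obj} (g : Hom Y Y') →
                    B₁ id (F⋆₁ (id ⊹ g)) ∘ ρ X Y
                    ≡ ρ X Y' ∘ Σ₁ (id ⁂ B₁ id g)
          dinatural : (X X' : Pointed) (Y : Obj) (f : Hom (obj X) (obj X')) →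
                      IsPointedHom X X' f →
                      B₁ id (F⋆₁ (f ⊹ id)) ∘ (ρ X Y ∘ Σ₁ (id ⁂ B₁ f id))
                      ≡ B₁ f id ∘ (ρ X' Y ∘ Σ₁ (f ⁂ id))

∃!≡ : ∀ {a b} {A : Set a} → (A → Set b) → Set (a ⊔ b)
∃!≡ {A = A} P = Σ A (λ x → P x × (∀ y → P y → y ≡ x))

-- a♣ is the zygomorphism of the algebra a and of
-- r = B(id, â) ∘ B(id, Σ⋆∇) ∘ ρ_{A,A} : Σ(A × B(A,A)) → B(A,A); the GSOS law plays
-- no further role.  For any functor with an initial algebra, the zygomorphism of
-- a and r : F(A × D) → D is the D-component of the fold of the paired algebra
-- ⟨a ∘ Fπ₁, r⟩ on A × D, and it is unique because ⟨(|a|), k⟩ is an algebra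
-- morphism into that paired algebra whenever k satisfies the recursion equation.
module Submission where

open import Defs
open import Relation.Binary.PropositionalEquality
  using (_≡_; refl; sym; trans; cong; module ≡-Reasoning)
open import Data.Product using (_,_)

module ProductLemmas {o ℓ} {C : Category o ℓ} (products : BinaryProducts C) where
  open Category C
  open BinaryProducts products

  ⟨⟩∘ : ∀ {W Z X Y} (f : Hom Z X) (g : Hom Z Y) (h : Hom W Z) →
        ⟨ f , g ⟩ ∘ h ≡ ⟨ f ∘ h , g ∘ h ⟩
  ⟨⟩∘ f g h = ⟨⟩-unique _ _ _
    (trans (sym (assoc _ _ _)) (cong (_∘ h) (π₁-β f g)))
    (trans (sym (assoc _ _ _)) (cong (_∘ h) (π₂-β f g)))

module Zygomorphism {o ℓ} {C : Category o ℓ} (products : BinaryProducts C)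
    (F : EndoMap C)
    (F-∘ : ∀ {X Y Z} (g : Category.Hom C Y Z) (f : Category.Hom C X Y) →
           EndoMap.F₁ F (Category._∘_ C g f) ≡ Category._∘_ C (EndoMap.F₁ F g) (EndoMap.F₁ F f))
    (init : InitialAlgebra C F) where
  open Category C
  open BinaryProducts products
  open ProductLemmas products
  open EndoMap F
  open InitialAlgebra init
  open ≡-Reasoning

  module _ {A D : Obj} (a : Hom (F₀ A) A) (r : Hom (F₀ (A ⊗ D)) D) where

    IsZygo : Hom μ D → Set ℓ
    IsZygo k = k ∘ ι ≡ r ∘ F₁ ⟨ fold (alg A a) , k ⟩

    pairedAlgebra : Algebra C F
    pairedAlgebra = alg (A ⊗ D) ⟨ a ∘ F₁ π₁ , r ⟩

    zygo : Hom μ D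
    zygo = π₂ ∘ fold pairedAlgebra

    paired-algebra-π₁ : ∀ (k : Hom μ (A ⊗ D)) → (a ∘ F₁ π₁) ∘ F₁ k ≡ a ∘ F₁ (π₁ ∘ k)
    paired-algebra-π₁ k = trans (assoc _ _ _) (cong (a ∘_) (sym (F-∘ π₁ k)))

    π₁∘fold-paired : π₁ ∘ fold pairedAlgebra ≡ fold (alg A a)
    π₁∘fold-paired = fold-unique (alg A a) _ (begin
      (π₁ ∘ fold pairedAlgebra) ∘ ι                ≡⟨ assoc _ _ _ ⟩
      π₁ ∘ fold pairedAlgebra ∘ ι                  ≡⟨ cong (π₁ ∘_) (fold-hom pairedAlgebra) ⟩
      π₁ ∘ ⟨ a ∘ F₁ π₁ , r ⟩ ∘ F₁ (fold pairedAlgebra) ≡⟨ sym (assoc _ _ _) ⟩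
      (π₁ ∘ ⟨ a ∘ F₁ π₁ , r ⟩) ∘ F₁ (fold pairedAlgebra) ≡⟨ cong (_∘ F₁ (fold pairedAlgebra)) (π₁-β _ _) ⟩
      (a ∘ F₁ π₁) ∘ F₁ (fold pairedAlgebra)        ≡⟨ paired-algebra-π₁ _ ⟩
      a ∘ F₁ (π₁ ∘ fold pairedAlgebra)             ∎)

    fold-paired≡⟨fold,zygo⟩ : fold pairedAlgebra ≡ ⟨ fold (alg A a) , zygo ⟩
    fold-paired≡⟨fold,zygo⟩ = ⟨⟩-unique _ _ _ π₁∘fold-paired refl

    zygo-isZygo : IsZygo zygo
    zygo-isZygo = begin
      (π₂ ∘ fold pairedAlgebra) ∘ ι                ≡⟨ assoc _ _ _ ⟩
      π₂ ∘ fold pairedAlgebra ∘ ι                  ≡⟨ cong (π₂ ∘_) (fold-hom pairedAlgebra) ⟩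
      π₂ ∘ ⟨ a ∘ F₁ π₁ , r ⟩ ∘ F₁ (fold pairedAlgebra) ≡⟨ sym (assoc _ _ _) ⟩
      (π₂ ∘ ⟨ a ∘ F₁ π₁ , r ⟩) ∘ F₁ (fold pairedAlgebra) ≡⟨ cong (_∘ F₁ (fold pairedAlgebra)) (π₂-β _ _) ⟩
      r ∘ F₁ (fold pairedAlgebra)                  ≡⟨ cong (λ m → r ∘ F₁ m) fold-paired≡⟨fold,zygo⟩ ⟩
      r ∘ F₁ ⟨ fold (alg A a) , zygo ⟩             ∎

    isZygo⇒pairing-isAlgHom : ∀ k → IsZygo k →
      IsAlgHom C F (alg μ ι) pairedAlgebra ⟨ fold (alg A a) , k ⟩
    isZygo⇒pairing-isAlgHom k k-zygo = begin
      ⟨ fold (alg A a) , k ⟩ ∘ ι                    ≡⟨ ⟨⟩∘ _ _ _ ⟩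
      ⟨ fold (alg A a) ∘ ι , k ∘ ι ⟩                ≡⟨ cong (⟨_, k ∘ ι ⟩) (fold-hom (alg A a)) ⟩
      ⟨ a ∘ F₁ (fold (alg A a)) , k ∘ ι ⟩           ≡⟨ cong (⟨ a ∘ F₁ (fold (alg A a)) ,_⟩) k-zygo ⟩
      ⟨ a ∘ F₁ (fold (alg A a)) , r ∘ F₁ pairing ⟩  ≡⟨ cong (λ m → ⟨ a ∘ F₁ m , r ∘ F₁ pairing ⟩) (sym (π₁-β _ _)) ⟩
      ⟨ a ∘ F₁ (π₁ ∘ pairing) , r ∘ F₁ pairing ⟩    ≡⟨ cong (⟨_, r ∘ F₁ pairing ⟩) (sym (paired-algebra-π₁ pairing)) ⟩
      ⟨ (a ∘ F₁ π₁) ∘ F₁ pairing , r ∘ F₁ pairing ⟩ ≡⟨ sym (⟨⟩∘ _ _ _) ⟩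
      ⟨ a ∘ F₁ π₁ , r ⟩ ∘ F₁ pairing                ∎
      where
      pairing : Hom μ (A ⊗ D)
      pairing = ⟨ fold (alg A a) , k ⟩

    zygo-unique : ∀ k → IsZygo k → k ≡ zygo
    zygo-unique k k-zygo = begin
      k                                 ≡⟨ sym (π₂-β _ _) ⟩
      π₂ ∘ ⟨ fold (alg A a) , k ⟩       ≡⟨ cong (π₂ ∘_) (fold-unique pairedAlgebra _ (isZygo⇒pairing-isAlgHom k k-zygo)) ⟩
      zygo                              ∎

module _ {o ℓ} {C : Category o ℓ} (colim : FinitelyCocomplete C) (lim : FinitelyComplete C)
         (V : Category.Obj C) (Σ' : Endofunctor C) where
  open Category C
  open BinaryCoproducts (FinitelyCocomplete.coproducts colim)
  open Setting C colim lim V Σ'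
  open EndoMap ΣF renaming (F₁ to Σ₁)
  open ≡-Reasoning
  module Σ' = Endofunctor Σ'

  Σ-∘ : ∀ {X Y Z} (g : Hom Y Z) (f : Hom X Y) → Σ₁ (g ∘ f) ≡ Σ₁ g ∘ Σ₁ f
  Σ-∘ g f = sym ([]-unique _ _ _ on-inl on-inr)
    where
    on-inl : (Σ₁ g ∘ Σ₁ f) ∘ inl ≡ inl ∘ id
    on-inl = begin
      (Σ₁ g ∘ Σ₁ f) ∘ inl   ≡⟨ assoc _ _ _ ⟩
      Σ₁ g ∘ Σ₁ f ∘ inl     ≡⟨ cong (Σ₁ g ∘_) (inl-β _ _) ⟩
      Σ₁ g ∘ inl ∘ id       ≡⟨ sym (assoc _ _ _) ⟩
      (Σ₁ g ∘ inl) ∘ id     ≡⟨ identityʳ _ ⟩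
      Σ₁ g ∘ inl            ≡⟨ inl-β _ _ ⟩
      inl ∘ id              ∎
    on-inr : (Σ₁ g ∘ Σ₁ f) ∘ inr ≡ inr ∘ Σ'.F₁ (g ∘ f)
    on-inr = begin
      (Σ₁ g ∘ Σ₁ f) ∘ inr          ≡⟨ assoc _ _ _ ⟩
      Σ₁ g ∘ Σ₁ f ∘ inr            ≡⟨ cong (Σ₁ g ∘_) (inr-β _ _) ⟩
      Σ₁ g ∘ inr ∘ Σ'.F₁ f         ≡⟨ sym (assoc _ _ _) ⟩
      (Σ₁ g ∘ inr) ∘ Σ'.F₁ f       ≡⟨ cong (_∘ Σ'.F₁ f) (inr-β _ _) ⟩
      (inr ∘ Σ'.F₁ g) ∘ Σ'.F₁ f    ≡⟨ assoc _ _ _ ⟩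
      inr ∘ Σ'.F₁ g ∘ Σ'.F₁ f      ≡⟨ cong (inr ∘_) (sym (Σ'.F-∘ g f)) ⟩
      inr ∘ Σ'.F₁ (g ∘ f)          ∎

lemma4p5 : ∀ {o ℓ} (C : Category o ℓ) (lim : FinitelyComplete C) (colim : FinitelyCocomplete C)
             (V : Category.Obj C) (Σ' : Endofunctor C)
             (freeΣ' : FreeAlgebras C (Endofunctor.endoMap Σ'))
             (init : InitialAlgebra C (Setting.ΣF C colim lim V Σ'))
             (fr : FreeAlgebras C (Setting.ΣF C colim lim V Σ'))
             (B : Bifunctor C)
             (law : Setting.Law.PointedGSOSLaw C colim lim V Σ' fr B)
             (A : Category.Obj C) (a : Category.Hom C (EndoMap.F₀ (Setting.ΣF C colim lim V Σ') A) A) →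
             let open Category C
                 open BinaryCoproducts (FinitelyCocomplete.coproducts colim)
                 open BinaryProducts (FinitelyComplete.products lim)
                 open Setting C colim lim V Σ'
                 open Law fr B
                 open FreeMonad C ΣF fr
                 open Bifunctor B
                 open InitialAlgebra init
                 open PointedGSOSLaw law
             in ∃!≡ (λ (a♣ : Hom μ (B₀ A A)) →
                  a♣ ∘ ι
                  ≡ B₁ id (hat (alg A a)) ∘ B₁ id (F⋆₁ ∇) ∘ ρ (algPointed (alg A a)) A
                    ∘ EndoMap.F₁ ΣF ⟨ fold (alg A a) , a♣ ⟩)
-- freeΣ' only guarantees that the free monad exists; fr is that choice of free algebras.
lemma4p5 C lim colim V Σ' _ init fr B law A a =
  zygo a r , trans (zygo-isZygo a r) (reassoc _) ,
  λ k k-eq → zygo-unique a r k (trans k-eq (sym (reassoc _)))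
  where
  open Category C
  open BinaryCoproducts (FinitelyCocomplete.coproducts colim) using (∇)
  open BinaryProducts (FinitelyComplete.products lim)
  open Setting C colim lim V Σ'
  open Law fr B
  open FreeMonad C ΣF fr
  open Bifunctor B
  open PointedGSOSLaw law
  open Zygomorphism (FinitelyComplete.products lim) ΣF (Σ-∘ colim lim V Σ') init

  r : Hom (EndoMap.F₀ ΣF (A ⊗ B₀ A A)) (B₀ A A)
  r = B₁ id (hat (alg A a)) ∘ B₁ id (F⋆₁ ∇) ∘ ρ (algPointed (alg A a)) A

  reassoc : ∀ {X} (m : Hom X (EndoMap.F₀ ΣF (A ⊗ B₀ A A))) →
            r ∘ m ≡ B₁ id (hat (alg A a)) ∘ B₁ id (F⋆₁ ∇) ∘ ρ (algPointed (alg A a)) A ∘ m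
  reassoc m = trans (assoc _ _ _) (cong (B₁ id (hat (alg A a)) ∘_) (assoc _ _ _))
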